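{- Let $n\ge 2$ and let $R$ be the $n\times n$ matrix with $(i,j)$ entry $a_{i,j}=\binom{i-1}{n-j}$, $1\le i,j\le n$. Let $b_{i,j}$ denote the $(i,j)$ entry of $R^2$ and $c_{i,j}$ the $(i,j)$ entry of $R^3$. Then \[ b_{i,j+1}=b_{i-1,j+1}+2b_{i-1,j}-b_{i,j}\quad\text{for all } 2\le i\le n,\ 1\le j\le n-1, \] and \[ c_{i+1,j}=2c_{i,j}+3c_{i,j-1}-2c_{i+1,j-1}\quad\text{for all } 1\le i\le n-1,\ 2\le j\le n. \]
   Context: Convention: $\binom{m}{k}=0$ if $k<0$ or $k>m$. Equivalently, $R$ is the $n\times n$ block (rows $i=1,\dots,n$, columns $j=1,\dots,n$) of the array $(a_{i,j})_{i\ge1,j\ge0}$ determined by $a_{1,n}=1$, $a_{1,j}=0$ for $j\neq n$, and $a_{i,j-1}=a_{i-1,j-1}+a_{i-1,j}$ for $i\ge 2$, $j\ge1$. -}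

module Defs where

open import Data.Nat using (ℕ; zero; suc; _∸_)
open import Data.Nat.Combinatorics using (_C_)
open import Data.Integer using (ℤ; +_; _+_; _*_)

-- Square matrices of size n with 1-based indices i, j ∈ {1,…,n},
-- represented as functions ℕ → ℕ → ℤ (entries outside 1..n are irrelevant).
Mat : Set
Mat = ℕ → ℕ → ℤ

sum1 : ℕ → (ℕ → ℤ) → ℤ
sum1 zero    f = + 0
sum1 (suc m) f = sum1 m f + f (suc m)

mul : ℕ → Mat → Mat → Mat
mul n A B i j = sum1 n (λ k → A i k * B k j)

-- R_{i,j} = binom(i-1, n-j)  (for 1 ≤ i, j ≤ n, n ∸ j is the true difference;
-- stdlib's C gives 0 when the lower index exceeds the upper)
R : ℕ → Mat
R n i j = + ((i ∸ 1) C (n ∸ j))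

R² : ℕ → Mat
R² n = mul n (R n) (R n)

R³ : ℕ → Mat
R³ n = mul n (R² n) (R n)

-- Let x and y be consecutive rows of R (first identity) or of R² (second),
-- and D a column of R.  Pascal's rule R(k,j) + R(k,j+1) = R(k+1,j) turns each
-- identity into Σ_k (u_k D_{k+1} + v_k D_k) = 0 with u, v linear in x and y,
-- and summation by parts reduces this to u_k + v_{k+1} = 0 for 1 ≤ k < n plus
-- two boundary terms.  For rows of R the interior conditions are Pascal's rule
-- along a row, and the boundary terms vanish as R(i-1,1) = 0 and
-- R(i,n) = R(i-1,n) = 1.  For rows of R² the interior conditions are the first
-- identity, and the boundary terms vanish as R(1,j) = 0 and
-- R²(i,n) = 2 R²(i-1,n), the case D = 1 of the argument for rows of R.
module Submission where

open import Defs
open import Data.Nat using (ℕ; zero; suc; _≤_; _<_; _∸_; s≤s)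
open import Data.Nat.Properties using (m<n⇒0<n∸m; +-comm; +-∸-assoc; n∸n≡0; m<n⇒m<1+n; n<1+n)
open import Data.Nat.Combinatorics using (_C_; k>n⇒nCk≡0; nCk+nC[k+1]≡[n+1]C[k+1])
open import Data.Integer using (ℤ; +_; -_; _+_; _-_; _*_)
open import Data.Integer.Properties using (+-inverseʳ; *-distribˡ-+; i-j≡0⇒i≡j; *-zeroˡ; *-zeroʳ)
open import Data.Integer.Tactic.RingSolver using (solve-∀)
open import Data.Product using (_×_; _,_)
open import Relation.Binary.PropositionalEquality
  using (_≡_; refl; sym; trans; cong; cong₂)
open Relation.Binary.PropositionalEquality.≡-Reasoning

sum1-cong : ∀ m {f g : ℕ → ℤ} → (∀ k → k < m → f (suc k) ≡ g (suc k)) →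
            sum1 m f ≡ sum1 m g
sum1-cong zero    eq = refl
sum1-cong (suc m) eq =
  cong₂ _+_ (sum1-cong m (λ k k<m → eq k (m<n⇒m<1+n k<m))) (eq m (n<1+n m))

sum1-≡0 : ∀ m {f : ℕ → ℤ} → (∀ k → k < m → f (suc k) ≡ + 0) → sum1 m f ≡ + 0
sum1-≡0 zero    eq = refl
sum1-≡0 (suc m) eq =
  cong₂ _+_ (sum1-≡0 m (λ k k<m → eq k (m<n⇒m<1+n k<m))) (eq m (n<1+n m))

sum1-+ : ∀ m (f g : ℕ → ℤ) → sum1 m (λ k → f k + g k) ≡ sum1 m f + sum1 m g
sum1-+ zero    f g = refl
sum1-+ (suc m) f g = trans (cong (_+ (f (suc m) + g (suc m))) (sum1-+ m f g))
                           (interchange (sum1 m f) (sum1 m g) (f (suc m)) (g (suc m)))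
  where
  interchange : ∀ a b c d → (a + b) + (c + d) ≡ (a + c) + (b + d)
  interchange = solve-∀

sum1-minus : ∀ m (f g : ℕ → ℤ) → sum1 m (λ k → f k - g k) ≡ sum1 m f - sum1 m g
sum1-minus zero    f g = refl
sum1-minus (suc m) f g = trans (cong (_+ (f (suc m) - g (suc m))) (sum1-minus m f g))
                           (interchange (sum1 m f) (sum1 m g) (f (suc m)) (g (suc m)))
  where
  interchange : ∀ a b c d → (a - b) + (c - d) ≡ (a + c) - (b + d)
  interchange = solve-∀

sum1-* : ∀ m (c : ℤ) (f : ℕ → ℤ) → sum1 m (λ k → c * f k) ≡ c * sum1 m f
sum1-* zero    c f = sym (*-zeroʳ c)
sum1-* (suc m) c f = trans (cong (_+ (c * f (suc m))) (sum1-* m c f))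
                           (sym (*-distribˡ-+ c (sum1 m f) (f (suc m))))

sum1-≡-by-difference : ∀ m (f g : ℕ → ℤ) → sum1 m (λ k → f k - g k) ≡ + 0 →
                       sum1 m f ≡ sum1 m g
sum1-≡-by-difference m f g eq = i-j≡0⇒i≡j _ _ (trans (sym (sum1-minus m f g)) eq)

sum1-by-parts : ∀ m (u v D : ℕ → ℤ) →
  sum1 (suc m) (λ k → u k * D (suc k) + v k * D k)
  ≡ (v 1 * D 1 + sum1 m (λ k → (u k + v (suc k)) * D (suc k))) + u (suc m) * D (suc (suc m))
sum1-by-parts zero    u v D = base (u 1) (v 1) (D 1) (D 2)
  where
  base : ∀ u₁ v₁ D₁ D₂ → + 0 + (u₁ * D₂ + v₁ * D₁) ≡ (v₁ * D₁ + + 0) + u₁ * D₂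
  base = solve-∀
sum1-by-parts (suc m) u v D =
  trans (cong (_+ (u (suc (suc m)) * D (suc (suc (suc m))) + v (suc (suc m)) * D (suc (suc m))))
              (sum1-by-parts m u v D))
        (step (v 1 * D 1) (sum1 m (λ k → (u k + v (suc k)) * D (suc k)))
              (u (suc m)) (v (suc (suc m))) (u (suc (suc m)))
              (D (suc (suc m))) (D (suc (suc (suc m)))))
  where
  step : ∀ a s u₁ v₂ u₂ D₂ D₃ →
         ((a + s) + u₁ * D₂) + (u₂ * D₃ + v₂ * D₂) ≡ (a + (s + (u₁ + v₂) * D₂)) + u₂ * D₃
  step = solve-∀

sum1-by-parts≡0 : ∀ m (u v D : ℕ → ℤ) → v 1 * D 1 ≡ + 0 →
  (∀ k → k < m → u (suc k) + v (suc (suc k)) ≡ + 0) → u (suc m) ≡ + 0 →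
  sum1 (suc m) (λ k → u k * D (suc k) + v k * D k) ≡ + 0
sum1-by-parts≡0 m u v D first interior last = begin
    sum1 (suc m) (λ k → u k * D (suc k) + v k * D k)
  ≡⟨ sum1-by-parts m u v D ⟩
    (v 1 * D 1 + sum1 m (λ k → (u k + v (suc k)) * D (suc k))) + u (suc m) * D (suc (suc m))
  ≡⟨ cong₂ (λ s t → (v 1 * D 1 + s) + t * D (suc (suc m))) interior-sum last ⟩
    (v 1 * D 1 + + 0) + + 0 * D (suc (suc m))
  ≡⟨ cong₂ (λ s t → (s + + 0) + t) first (*-zeroˡ (D (suc (suc m)))) ⟩
    + 0
  ∎
  where
  interior-sum : sum1 m (λ k → (u k + v (suc k)) * D (suc k)) ≡ + 0
  interior-sum = sum1-≡0 m (λ k k<m →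
    trans (cong (_* D (suc (suc k))) (interior k k<m)) (*-zeroˡ (D (suc (suc k)))))

R-above-antidiagonal : ∀ n i j → i < n ∸ j → R n (suc i) j ≡ + 0
R-above-antidiagonal n i j i<n∸j = cong +_ (k>n⇒nCk≡0 i<n∸j)

R-last-column : ∀ n i → R n (suc i) n ≡ + 1
R-last-column n i = cong (λ t → + (i C t)) (n∸n≡0 n)

R-pascal : ∀ n i j → suc j ≤ n → R n (suc i) j + R n (suc i) (suc j) ≡ R n (suc (suc i)) j
R-pascal n i j le = begin
    + (i C (n ∸ j)) + + (i C (n ∸ suc j))
  ≡⟨ cong (λ t → + (i C t) + + (i C (n ∸ suc j))) n∸j≡1+n∸[1+j] ⟩
    + (i C suc (n ∸ suc j)) + + (i C (n ∸ suc j))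
  ≡⟨ cong +_ (trans (+-comm (i C suc (n ∸ suc j)) _) (nCk+nC[k+1]≡[n+1]C[k+1] i (n ∸ suc j))) ⟩
    + (suc i C suc (n ∸ suc j))
  ≡⟨ cong (λ t → + (suc i C t)) n∸j≡1+n∸[1+j] ⟨
    + (suc i C (n ∸ j))
  ∎
  where
  n∸j≡1+n∸[1+j] : n ∸ j ≡ suc (n ∸ suc j)
  n∸j≡1+n∸[1+j] = +-∸-assoc 1 le

R-rows-by-parts : ∀ m a (D : ℕ → ℤ) → suc (suc a) ≤ suc m →
  sum1 (suc m) (λ k → (R (suc m) (suc (suc a)) k - R (suc m) (suc a) k) * D (suc k)
                      + (- R (suc m) (suc a) k) * D k)
  ≡ + 0
R-rows-by-parts m a D (s≤s a<m) =
  sum1-by-parts≡0 m (λ k → x k - y k) (λ k → - y k) D first interior last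
  where
  n : ℕ
  n = suc m
  x y : ℕ → ℤ
  x = R n (suc (suc a))
  y = R n (suc a)
  first : - y 1 * D 1 ≡ + 0
  first = trans (cong (λ t → - t * D 1) (R-above-antidiagonal n a 1 a<m)) (*-zeroˡ (D 1))
  cancel : ∀ y₁ y₂ → ((y₁ + y₂) - y₁) + - y₂ ≡ + 0
  cancel = solve-∀
  interior : ∀ k → k < m → (x (suc k) - y (suc k)) + - y (suc (suc k)) ≡ + 0
  interior k k<m =
    trans (cong (λ t → (t - y (suc k)) + - y (suc (suc k))) (sym (R-pascal n a (suc k) (s≤s k<m))))
          (cancel (y (suc k)) (y (suc (suc k))))
  last : x n - y n ≡ + 0
  last = cong₂ _-_ (R-last-column n (suc a)) (R-last-column n a)

R²-row-recurrence : ∀ m a j → suc (suc a) ≤ suc m → suc j ≤ suc m →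
  R² (suc m) (suc (suc a)) (suc j)
  ≡ (R² (suc m) (suc a) (suc j) + + 2 * R² (suc m) (suc a) j) - R² (suc m) (suc (suc a)) j
R²-row-recurrence m a j a+2≤n j<n = begin
    sum1 n (λ k → x k * E k)
  ≡⟨ sum1-≡-by-difference n _ _
       (trans (sum1-cong n (λ k _ → pointwise k)) (R-rows-by-parts m a D a+2≤n)) ⟩
    sum1 n (λ k → (y k * E k + + 2 * (y k * D k)) - x k * D k)
  ≡⟨ sum1-minus n _ _ ⟩
    sum1 n (λ k → y k * E k + + 2 * (y k * D k)) - sum1 n (λ k → x k * D k)
  ≡⟨ cong (_- sum1 n (λ k → x k * D k))
          (trans (sum1-+ n _ _) (cong (λ t → sum1 n (λ k → y k * E k) + t) (sum1-* n (+ 2) _))) ⟩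
    (sum1 n (λ k → y k * E k) + + 2 * sum1 n (λ k → y k * D k)) - sum1 n (λ k → x k * D k)
  ∎
  where
  n : ℕ
  n = suc m
  x y D E : ℕ → ℤ
  x = R n (suc (suc a))
  y = R n (suc a)
  D k = R n k j
  E k = R n k (suc j)
  expand : ∀ x y D E →
    x * E - ((y * E + + 2 * (y * D)) - x * D) ≡ (x - y) * (D + E) + (- y) * D
  expand = solve-∀
  pointwise : ∀ k →
    x (suc k) * E (suc k)
      - ((y (suc k) * E (suc k) + + 2 * (y (suc k) * D (suc k))) - x (suc k) * D (suc k))
    ≡ (x (suc k) - y (suc k)) * D (suc (suc k)) + (- y (suc k)) * D (suc k)
  pointwise k = trans (expand (x (suc k)) (y (suc k)) (D (suc k)) (E (suc k)))
                      (cong (λ t → (x (suc k) - y (suc k)) * t + (- y (suc k)) * D (suc k))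
                            (R-pascal n k j j<n))

R²-last-column-doubles : ∀ m a → suc (suc a) ≤ suc m →
  R² (suc m) (suc (suc a)) (suc m) ≡ + 2 * R² (suc m) (suc a) (suc m)
R²-last-column-doubles m a a+2≤n = begin
    sum1 n (λ k → x k * R n k n)
  ≡⟨ sum1-≡-by-difference n _ _
       (trans (sum1-cong n (λ k _ → pointwise k)) (R-rows-by-parts m a (λ _ → + 1) a+2≤n)) ⟩
    sum1 n (λ k → + 2 * (y k * R n k n))
  ≡⟨ sum1-* n (+ 2) _ ⟩
    + 2 * sum1 n (λ k → y k * R n k n)
  ∎
  where
  n : ℕ
  n = suc m
  x y : ℕ → ℤ
  x = R n (suc (suc a))
  y = R n (suc a)
  expand : ∀ x y → x * + 1 - + 2 * (y * + 1) ≡ (x - y) * + 1 + (- y) * + 1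
  expand = solve-∀
  pointwise : ∀ k → x (suc k) * R n (suc k) n - + 2 * (y (suc k) * R n (suc k) n)
                  ≡ (x (suc k) - y (suc k)) * + 1 + (- y (suc k)) * + 1
  pointwise k = trans (cong (λ t → x (suc k) * t - + 2 * (y (suc k) * t)) (R-last-column n k))
                      (expand (x (suc k)) (y (suc k)))

R³-row-recurrence : ∀ m a j → suc (suc a) ≤ suc m → j < suc m →
  R³ (suc m) (suc (suc a)) (suc j)
  ≡ (+ 2 * R³ (suc m) (suc a) (suc j) + + 3 * R³ (suc m) (suc a) j) - + 2 * R³ (suc m) (suc (suc a)) j
R³-row-recurrence m a j a+2≤n j<n = begin
    sum1 n (λ k → x k * E k)
  ≡⟨ sum1-≡-by-difference n _ _
       (trans (sum1-cong n (λ k _ → pointwise k))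
              (sum1-by-parts≡0 m (λ k → x k - + 2 * y k) (λ k → x k - y k) D first interior last)) ⟩
    sum1 n (λ k → (+ 2 * (y k * E k) + + 3 * (y k * D k)) - + 2 * (x k * D k))
  ≡⟨ sum1-minus n _ _ ⟩
    sum1 n (λ k → + 2 * (y k * E k) + + 3 * (y k * D k)) - sum1 n (λ k → + 2 * (x k * D k))
  ≡⟨ cong₂ _-_ (trans (sum1-+ n _ _) (cong₂ _+_ (sum1-* n (+ 2) _) (sum1-* n (+ 3) _)))
               (sum1-* n (+ 2) _) ⟩
    (+ 2 * sum1 n (λ k → y k * E k) + + 3 * sum1 n (λ k → y k * D k))
      - + 2 * sum1 n (λ k → x k * D k)
  ∎
  where
  n : ℕ
  n = suc m
  x y D E : ℕ → ℤ
  x = R² n (suc (suc a))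
  y = R² n (suc a)
  D k = R n k j
  E k = R n k (suc j)
  expand : ∀ x y D E →
    x * E - ((+ 2 * (y * E) + + 3 * (y * D)) - + 2 * (x * D))
    ≡ (x - + 2 * y) * (D + E) + (x - y) * D
  expand = solve-∀
  pointwise : ∀ k →
    x (suc k) * E (suc k) - ((+ 2 * (y (suc k) * E (suc k)) + + 3 * (y (suc k) * D (suc k)))
                             - + 2 * (x (suc k) * D (suc k)))
    ≡ (x (suc k) - + 2 * y (suc k)) * D (suc (suc k)) + (x (suc k) - y (suc k)) * D (suc k)
  pointwise k = trans (expand (x (suc k)) (y (suc k)) (D (suc k)) (E (suc k)))
                      (cong (λ t → (x (suc k) - + 2 * y (suc k)) * t + (x (suc k) - y (suc k)) * D (suc k))
                            (R-pascal n k j j<n))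
  first : (x 1 - y 1) * D 1 ≡ + 0
  first = trans (cong ((x 1 - y 1) *_) (R-above-antidiagonal n 0 j (m<n⇒0<n∸m j<n)))
                (*-zeroʳ (x 1 - y 1))
  cancel : ∀ x₁ y₁ y₂ → (x₁ - + 2 * y₁) + (((y₂ + + 2 * y₁) - x₁) - y₂) ≡ + 0
  cancel = solve-∀
  interior : ∀ k → k < m → (x (suc k) - + 2 * y (suc k)) + (x (suc (suc k)) - y (suc (suc k))) ≡ + 0
  interior k k<m =
    trans (cong (λ t → (x (suc k) - + 2 * y (suc k)) + (t - y (suc (suc k))))
                (R²-row-recurrence m a (suc k) a+2≤n (s≤s k<m)))
          (cancel (x (suc k)) (y (suc k)) (y (suc (suc k))))
  last : x n - + 2 * y n ≡ + 0
  last = trans (cong (_- + 2 * y n) (R²-last-column-doubles m a a+2≤n)) (+-inverseʳ (+ 2 * y n))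

lemma2 : (n : ℕ) → 2 ≤ n →
    ((i j : ℕ) → 2 ≤ i → i ≤ n → 1 ≤ j → suc j ≤ n →
      R² n i (suc j) ≡ (R² n (i ∸ 1) (suc j) + (+ 2) * R² n (i ∸ 1) j) - R² n i j)
    ×
    ((i j : ℕ) → 1 ≤ i → suc i ≤ n → 2 ≤ j → j ≤ n →
      R³ n (suc i) j ≡ ((+ 2) * R³ n i j + (+ 3) * R³ n i (j ∸ 1)) - (+ 2) * R³ n (suc i) (j ∸ 1))
lemma2 (suc m) _ = R²-recurrence , R³-recurrence
  where
  R²-recurrence : (i j : ℕ) → 2 ≤ i → i ≤ suc m → 1 ≤ j → suc j ≤ suc m →
    R² (suc m) i (suc j) ≡ (R² (suc m) (i ∸ 1) (suc j) + + 2 * R² (suc m) (i ∸ 1) j) - R² (suc m) i j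
  R²-recurrence (suc (suc a)) j _ i≤n _ j<n = R²-row-recurrence m a j i≤n j<n
  R²-recurrence (suc zero) _ (s≤s ()) _ _ _
  R³-recurrence : (i j : ℕ) → 1 ≤ i → suc i ≤ suc m → 2 ≤ j → j ≤ suc m →
    R³ (suc m) (suc i) j ≡ (+ 2 * R³ (suc m) i j + + 3 * R³ (suc m) i (j ∸ 1)) - + 2 * R³ (suc m) (suc i) (j ∸ 1)
  R³-recurrence (suc a) (suc j) _ i<n _ j≤n = R³-row-recurrence m a j i<n j≤n
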